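{- Let $\phi$ be a first-order standpoint logic sentence and $\mathfrak{M}=\langle\Delta,\Pi,\sigma,\gamma\rangle$ a model of $\phi$. Then for any $n\ge|\Pi|$ there exists a model $\mathfrak{M}'=\langle\Delta,\Pi',\sigma',\gamma'\rangle$ of $\phi$ with $|\Pi'|=n$.
   Context: FOSL: signature $\langle\mathbf{P},\mathbf{C},\mathbf{S}\rangle$ with $*\in\mathbf{S}$; standpoint expressions $e ::= s\mid e_1\cap e_2\mid e_1\cup e_2\mid e_1\setminus e_2$; formulae $\phi ::= P(t_1,\dots,t_k)\mid t_1\doteq t_2\mid\neg\phi\mid\phi\wedge\psi\mid\exists^{\lhd n}x.\phi\mid\Diamond_e\phi$. A standpoint structure $\langle\Delta,\Pi,\sigma,\gamma\rangle$ has a nonempty domain $\Delta$, a nonempty set $\Pi$ of precisifications, $\sigma:\mathbf{S}\to2^\Pi$ with $\sigma(*)=\Pi$ (extended set-theoretically to expressions), and $\gamma(\pi)$ a first-order structure over $\Delta$ for each $\pi$, constants interpreted identically in all precisifications. Satisfaction: standard in $\gamma(\pi)$; $\Diamond_e\phi$ holds at $\pi$ iff $\phi$ holds at some $\pi'\in\sigma(e)$ under the same assignment. $\mathfrak{M}$ is a model of $\phi$ iff $\phi$ holds at every precisification under every assignment. -}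

module Defs where

open import Data.Nat using (ℕ; suc)
open import Data.Fin using (Fin; zero; suc)
open import Data.Vec using (Vec; map)
open import Data.Product using (Σ; _×_; _,_)
open import Data.Sum using (_⊎_)
open import Data.Empty using (⊥)
open import Relation.Nullary using (¬_)
open import Relation.Binary.PropositionalEquality using (_≡_)
open import Function.Definitions using (Injective)

record Signature : Set₁ where
  field
    PSym  : Set
    arity : PSym → ℕ
    CSym  : Set
    SSym  : Set
    star  : SSym

module _ (Sig : Signature) where
  open Signature Sig

  data SExpr : Set where
    sym   : SSym → SExpr
    _∩ₛ_  : SExpr → SExpr → SExpr
    _∪ₛ_  : SExpr → SExpr → SExpr
    _∖ₛ_  : SExpr → SExpr → SExpr

  data Term (k : ℕ) : Set where
    var   : Fin k → Term k
    const : CSym → Term k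

  data Cmp : Set where
    lt le eq ge gt : Cmp

  -- Formulae over k variables (de Bruijn: the quantifier binds variable 0).
  data Formula (k : ℕ) : Set where
    pred  : (P : PSym) → Vec (Term k) (arity P) → Formula k
    _≐_   : Term k → Term k → Formula k
    neg   : Formula k → Formula k
    _∧_   : Formula k → Formula k → Formula k
    count : Cmp → ℕ → Formula (suc k) → Formula k
    dia   : SExpr → Formula k → Formula k

  Sentence : Set
  Sentence = Formula 0

  record Structure (Δ : Set) : Set₁ where
    field
      Δ-nonempty : Δ
      Π          : Set
      Π-nonempty : Π
      σ          : SSym → Π → Set
      σ-star     : ∀ π → σ star π
      cst        : CSym → Δ
      prd        : Π → (P : PSym) → Vec Δ (arity P) → Set

  module Sem {Δ : Set} (M : Structure Δ) where
    open Structure M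

    σᵉ : SExpr → Π → Set
    σᵉ (sym s)   π = σ s π
    σᵉ (e ∩ₛ e′) π = σᵉ e π × σᵉ e′ π
    σᵉ (e ∪ₛ e′) π = σᵉ e π ⊎ σᵉ e′ π
    σᵉ (e ∖ₛ e′) π = σᵉ e π × ¬ σᵉ e′ π

    ⟦_⟧ₜ : ∀ {k} → Term k → (Fin k → Δ) → Δ
    ⟦ var i ⟧ₜ   v = v i
    ⟦ const c ⟧ₜ v = cst c

    extend : ∀ {k} → Δ → (Fin k → Δ) → Fin (suc k) → Δ
    extend d v zero    = d
    extend d v (suc i) = v i

    AtLeast : ℕ → (Δ → Set) → Set
    AtLeast m Q = Σ (Fin m → Δ) λ f → Injective _≡_ _≡_ f × (∀ i → Q (f i))

    CountSat : Cmp → ℕ → (Δ → Set) → Set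
    CountSat lt m Q = ¬ AtLeast m Q
    CountSat le m Q = ¬ AtLeast (suc m) Q
    CountSat eq m Q = AtLeast m Q × ¬ AtLeast (suc m) Q
    CountSat ge m Q = AtLeast m Q
    CountSat gt m Q = AtLeast (suc m) Q

    Sat : ∀ {k} → Π → (Fin k → Δ) → Formula k → Set
    Sat π v (pred P ts) = prd π P (map (λ t → ⟦ t ⟧ₜ v) ts)
    Sat π v (t ≐ u)     = ⟦ t ⟧ₜ v ≡ ⟦ u ⟧ₜ v
    Sat π v (neg φ)     = ¬ Sat π v φ
    Sat π v (φ ∧ ψ)     = Sat π v φ × Sat π v ψ
    Sat π v (count c m φ) = CountSat c m (λ d → Sat π (extend d v) φ)
    Sat π v (dia e φ)   = Σ Π λ π′ → σᵉ e π′ × Sat π′ v φ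

  IsModel : ∀ {Δ k} → Structure Δ → Formula k → Set
  IsModel M φ = ∀ π v → Sem.Sat M π v φ

-- Duplicating precisifications does not change what a sentence can say. Precomposing all of
-- σ and γ with a surjection r : Π′ ↠ Π gives a structure in which every precisification i satisfies
-- exactly what r i satisfied, since ◇ only asks for some witness precisification and r hits every one.
-- A surjection Fin n ↠ Π exists whenever |Π| = m ≤ n: send the first m indices onto Π and the rest to
-- a fixed precisification.
module Submission where

open import Defs
open import Data.Nat using (ℕ; _≤_; _+_)
open import Data.Nat.Properties using (m≤n⇒∃[o]m+o≡n)
open import Data.Fin using (Fin; splitAt; _↑ˡ_)
open import Data.Fin.Properties using (splitAt-↑ˡ)
open import Data.Product using (Σ; _×_; _,_)
open import Data.Product.Function.NonDependent.Propositional using (_×-⇔_)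
open import Data.Sum using ([_,_]′)
open import Data.Sum.Function.Propositional using (_⊎-⇔_)
open import Data.Vec using (map)
open import Data.Vec.Properties using (map-cong)
open import Function using (_∘_)
open import Function.Bundles using (_↔_; _↠_; _⇔_; mk⇔; mk↠ₛ; Inverse; Surjection; Equivalence)
open import Function.Construct.Identity using (⇔-id)
open import Function.Properties.Inverse using (↔-refl)
open import Function.Related.TypeIsomorphisms using (¬-cong-⇔)
open import Relation.Binary.PropositionalEquality using (_≡_; refl; trans; cong; subst₂; subst)
import Relation.Binary.PropositionalEquality as ≡

module _ (Sig : Signature) {Δ : Set} (M : Structure Sig Δ) where
  open Equivalence using (to; from)
  open Structure M
  open Sem Sig M

  AtLeast-cong : ∀ {m} {Q R : Δ → Set} → (∀ d → Q d ⇔ R d) → AtLeast m Q ⇔ AtLeast m R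
  AtLeast-cong Q⇔R = mk⇔
    (λ (f , f-inj , Qf) → f , f-inj , λ j → to (Q⇔R (f j)) (Qf j))
    (λ (f , f-inj , Rf) → f , f-inj , λ j → from (Q⇔R (f j)) (Rf j))

  CountSat-cong : ∀ c m {Q R : Δ → Set} → (∀ d → Q d ⇔ R d) → CountSat c m Q ⇔ CountSat c m R
  CountSat-cong Cmp.lt m Q⇔R = ¬-cong-⇔ (AtLeast-cong Q⇔R)
  CountSat-cong Cmp.le m Q⇔R = ¬-cong-⇔ (AtLeast-cong Q⇔R)
  CountSat-cong Cmp.eq m Q⇔R = AtLeast-cong Q⇔R ×-⇔ ¬-cong-⇔ (AtLeast-cong Q⇔R)
  CountSat-cong Cmp.ge m Q⇔R = AtLeast-cong Q⇔R
  CountSat-cong Cmp.gt m Q⇔R = AtLeast-cong Q⇔R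

  module _ {Π′ : Set} (r : Π′ ↠ Π) where
    open Surjection r using (to⁻; to∘to⁻) renaming (to to r⟨_⟩)

    pullback : Structure Sig Δ
    pullback = record
      { Δ-nonempty = Δ-nonempty
      ; Π          = Π′
      ; Π-nonempty = to⁻ Π-nonempty
      ; σ          = λ s i → σ s r⟨ i ⟩
      ; σ-star     = λ i → σ-star r⟨ i ⟩
      ; cst        = cst
      ; prd        = λ i → prd r⟨ i ⟩
      }

    private module S′ = Sem Sig pullback

    σᵉ-pullback : ∀ e i → S′.σᵉ e i ⇔ σᵉ e r⟨ i ⟩
    σᵉ-pullback (sym s)   i = ⇔-id _
    σᵉ-pullback (e ∩ₛ e′) i = σᵉ-pullback e i ×-⇔ σᵉ-pullback e′ i
    σᵉ-pullback (e ∪ₛ e′) i = σᵉ-pullback e i ⊎-⇔ σᵉ-pullback e′ i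
    σᵉ-pullback (e ∖ₛ e′) i = σᵉ-pullback e i ×-⇔ ¬-cong-⇔ (σᵉ-pullback e′ i)

    ⟦⟧ₜ-pullback : ∀ {k} (t : Term Sig k) v → S′.⟦ t ⟧ₜ v ≡ ⟦ t ⟧ₜ v
    ⟦⟧ₜ-pullback (var x)   v = refl
    ⟦⟧ₜ-pullback (const c) v = refl

    Sat-pullback : ∀ {k} (φ : Formula Sig k) i v → S′.Sat i v φ ⇔ Sat r⟨ i ⟩ v φ
    Sat-pullback (pred P ts) i v = mk⇔ (subst (prd r⟨ i ⟩ P) ts≡) (subst (prd r⟨ i ⟩ P) (≡.sym ts≡))
      where
      ts≡ : map (λ t → S′.⟦ t ⟧ₜ v) ts ≡ map (λ t → ⟦ t ⟧ₜ v) ts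
      ts≡ = map-cong (λ t → ⟦⟧ₜ-pullback t v) ts
    Sat-pullback (t ≐ u) i v = mk⇔
      (subst₂ _≡_ (⟦⟧ₜ-pullback t v) (⟦⟧ₜ-pullback u v))
      (subst₂ _≡_ (≡.sym (⟦⟧ₜ-pullback t v)) (≡.sym (⟦⟧ₜ-pullback u v)))
    Sat-pullback (neg φ) i v = ¬-cong-⇔ (Sat-pullback φ i v)
    Sat-pullback (φ ∧ ψ) i v = Sat-pullback φ i v ×-⇔ Sat-pullback ψ i v
    Sat-pullback (count c m φ) i v = CountSat-cong c m (λ d → Sat-pullback φ i (extend d v))
    Sat-pullback (dia e φ) i v = mk⇔
      (λ (j , j∈e , j⊨φ) → r⟨ j ⟩ , to (σᵉ-pullback e j) j∈e , to (Sat-pullback φ j v) j⊨φ)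
      (λ (π , π∈e , π⊨φ) → witness (to∘to⁻ π) π∈e π⊨φ)
      where
      witness : ∀ {j π} → r⟨ j ⟩ ≡ π → σᵉ e π → Sat π v φ → S′.Sat i v (dia e φ)
      witness {j} refl π∈e π⊨φ = j , from (σᵉ-pullback e j) π∈e , from (Sat-pullback φ j v) π⊨φ

    pullback-isModel : ∀ {k} (φ : Formula Sig k) → IsModel Sig M φ → IsModel Sig pullback φ
    pullback-isModel φ M⊨φ i v = from (Sat-pullback φ i v) (M⊨φ r⟨ i ⟩ v)

padding-↠ : ∀ {A : Set} {m} k → A → A ↔ Fin m → Fin (m + k) ↠ A
padding-↠ {m = m} k a A↔Fin = mk↠ₛ {to = [ from , (λ _ → a) ]′ ∘ splitAt m} λ x →
  to x ↑ˡ k , trans (cong [ from , (λ _ → a) ]′ (splitAt-↑ˡ m (to x) k)) (strictlyInverseʳ x)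
  where open Inverse A↔Fin

lemma1 : (Sig : Signature) (φ : Sentence Sig) {Δ : Set} (M : Structure Sig Δ)
         → IsModel Sig M φ
         → (m : ℕ) → Structure.Π M ↔ Fin m
         → (n : ℕ) → m ≤ n
         → Σ (Structure Sig Δ) λ M′ → IsModel Sig M′ φ × (Structure.Π M′ ↔ Fin n)
lemma1 Sig φ M M⊨φ m Π↔Fin n m≤n with m≤n⇒∃[o]m+o≡n m≤n
... | k , refl = pullback Sig M r , pullback-isModel Sig M r φ M⊨φ , ↔-refl
  where
  r : Fin (m + k) ↠ Structure.Π M
  r = padding-↠ k (Structure.Π-nonempty M) Π↔Fin
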